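{- Let $\Sigma=\{\veebar,\wedge,\vee,\mathbin{\dot\vee}\}$ and $n\geq 1$, and let $p_1,\dots,p_n,q,q_1,\dots,q_n$ be pairwise distinct propositional variables. \begin{itemize} \item Every $\mathrm{PL}(\Sigma)$-formula that defines (is equivalent to) the dependence atom $=\!\!(p_1\cdots p_n;q)$ has length at least $2^n$. \item Every $\mathrm{PL}(\Sigma)$-formula that defines (is equivalent to) the exclusion atom $p_1\cdots p_n\mid q_1\cdots q_n$ has length at least $2^n$. \end{itemize}
   Context: A domain $\Phi$ is a finite set of propositional variables; a $\Phi$-assignment is a map $s:\Phi\to\{0,1\}$; a $\Phi$-team is a (possibly empty) set of $\Phi$-assignments. A split of a team $T$ is a pair $(T_1,T_2)$ with $T_1,T_2\subseteq T$ and $T_1\cup T_2=T$; it is strict if $T_1\cap T_2=\emptyset$. $\mathrm{PL}(\Sigma)$ is the set of formulas built from the literals $\top,\bot,{\sim}\top,{\sim}\bot,p,\neg p,{\sim}p,{\sim}\neg p$ by the connectives in $\Sigma$. Semantics on a team $T$: $T\models\top$ always; $T\models\bot$ iff $T=\emptyset$; $T\models p$ iff $s(p)=1$ for all $s\in T$; $T\models\neg p$ iff $s(p)=0$ for all $s\in T$; $T\models{\sim}\psi$ iff $T\not\models\psi$; $\wedge$ is conjunction; $T\models\psi\veebar\theta$ iff $T\models\psi$ or $T\models\theta$; $T\models\psi\vee\theta$ iff some split $(S,U)$ of $T$ has $S\models\psi$, $U\models\theta$; $T\models\psi\mathbin{\dot\vee}\theta$ iff some strict split does. Two formulas are equivalent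 if they are satisfied by the same teams for every domain containing all their variables. Length of a formula = its length as a string, each variable counting as one symbol. Atoms: $T\models\,=\!\!(\vec p;q)$ iff for all $s,s'\in T$, $s(\vec p)=s'(\vec p)$ implies $s(q)=s'(q)$; $T\models\vec p\mid\vec q$ iff $s(\vec p)\neq s'(\vec q)$ for all $s,s'\in T$. -}

module Defs where

open import Data.Nat using (ℕ; _+_; _≡ᵇ_)
open import Data.Bool using (Bool; true; false; if_then_else_; _∨_; _∧_)
open import Data.List using (List; []; _∷_; _++_)
open import Data.List.Relation.Unary.All using (All; []; _∷_)
open import Data.List.Relation.Unary.Unique.Propositional using (Unique)
open import Data.List.Membership.Propositional using (_∈_)
open import Data.Fin using (Fin)
open import Data.Vec using (tabulate; toList)
open import Data.Product using (Σ; _×_)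
open import Data.Sum using (_⊎_)
open import Data.Unit using (⊤)
open import Data.Empty using (⊥)
open import Relation.Nullary using (¬_)
open import Relation.Binary.PropositionalEquality using (_≡_)
open import Function.Bundles using (_⇔_)

Var : Set
Var = ℕ

-- A domain Φ: a finite set of variables, given as a duplicate-free list
-- (Unique is required wherever domains are quantified over).
Domain : Set
Domain = List Var

Assign : Domain → Set
Assign Φ = All (λ _ → Bool) Φ

-- s(x): value of variable x under s (false if x ∉ Φ; never used for x ∈ Φ).
val : {Φ : Domain} → Assign Φ → Var → Bool
val {[]} [] y = false
val {x ∷ Φ} (b ∷ s) y = if x ≡ᵇ y then b else val s y

Team : Domain → Set
Team Φ = Assign Φ → Bool

-- Literals: ⊤, ⊥, ∼⊤, ∼⊥, p, ¬p, ∼p, ∼¬p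
data Lit : Set where
  lTop lBot lNTop lNBot : Lit
  lPos lNeg lNPos lNNeg : Var → Lit

data Form : Set where
  lit   : Lit → Form
  _⊻_   : Form → Form → Form
  _∧ᶠ_  : Form → Form → Form
  _∨ᶠ_  : Form → Form → Form
  _∨̇_   : Form → Form → Form

litVars : Lit → List Var
litVars (lPos x) = x ∷ []
litVars (lNeg x) = x ∷ []
litVars (lNPos x) = x ∷ []
litVars (lNNeg x) = x ∷ []
litVars _ = []

vars : Form → List Var
vars (lit l) = litVars l
vars (φ ⊻ ψ) = vars φ ++ vars ψ
vars (φ ∧ᶠ ψ) = vars φ ++ vars ψ
vars (φ ∨ᶠ ψ) = vars φ ++ vars ψ
vars (φ ∨̇ ψ) = vars φ ++ vars ψ

-- Length as a string: every symbol (incl. each variable, ∼, ¬, the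
-- connective, and the two parentheses around a binary formula) counts 1.
litLen : Lit → ℕ
litLen lTop = 1
litLen lBot = 1
litLen lNTop = 2
litLen lNBot = 2
litLen (lPos x) = 1
litLen (lNeg x) = 2
litLen (lNPos x) = 2
litLen (lNNeg x) = 3

len : Form → ℕ
len (lit l) = litLen l
len (φ ⊻ ψ) = len φ + len ψ + 3
len (φ ∧ᶠ ψ) = len φ + len ψ + 3
len (φ ∨ᶠ ψ) = len φ + len ψ + 3
len (φ ∨̇ ψ) = len φ + len ψ + 3

Empty : {Φ : Domain} → Team Φ → Set
Empty {Φ} T = (s : Assign Φ) → T s ≡ false

AllVal : {Φ : Domain} → Team Φ → Var → Bool → Set
AllVal {Φ} T x b = (s : Assign Φ) → T s ≡ true → val s x ≡ b

IsSplit : {Φ : Domain} → Team Φ → Team Φ → Team Φ → Set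
IsSplit {Φ} T T₁ T₂ = (s : Assign Φ) → T s ≡ (T₁ s ∨ T₂ s)

Disjoint : {Φ : Domain} → Team Φ → Team Φ → Set
Disjoint {Φ} T₁ T₂ = (s : Assign Φ) → (T₁ s ∧ T₂ s) ≡ false

SatLit : {Φ : Domain} → Team Φ → Lit → Set
SatLit T lTop = ⊤
SatLit T lBot = Empty T
SatLit T lNTop = ⊥
SatLit T lNBot = ¬ Empty T
SatLit T (lPos x) = AllVal T x true
SatLit T (lNeg x) = AllVal T x false
SatLit T (lNPos x) = ¬ AllVal T x true
SatLit T (lNNeg x) = ¬ AllVal T x false

Sat : {Φ : Domain} → Team Φ → Form → Set
Sat T (lit l) = SatLit T l
Sat T (φ ⊻ ψ) = Sat T φ ⊎ Sat T ψ
Sat T (φ ∧ᶠ ψ) = Sat T φ × Sat T ψ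
Sat {Φ} T (φ ∨ᶠ ψ) = Σ (Team Φ) λ T₁ → Σ (Team Φ) λ T₂ →
  IsSplit T T₁ T₂ × Sat T₁ φ × Sat T₂ ψ
Sat {Φ} T (φ ∨̇ ψ) = Σ (Team Φ) λ T₁ → Σ (Team Φ) λ T₂ →
  IsSplit T T₁ T₂ × Disjoint T₁ T₂ × Sat T₁ φ × Sat T₂ ψ

DepAtom : {Φ : Domain} {n : ℕ} → Team Φ → (Fin n → Var) → Var → Set
DepAtom {Φ} T p q = (s s' : Assign Φ) → T s ≡ true → T s' ≡ true →
  ((i : Fin _) → val s (p i) ≡ val s' (p i)) → val s q ≡ val s' q

ExclAtom : {Φ : Domain} {n : ℕ} → Team Φ → (Fin n → Var) → (Fin n → Var) → Set
ExclAtom {Φ} T p q = (s s' : Assign Φ) → T s ≡ true → T s' ≡ true →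
  ¬ ((i : Fin _) → val s (p i) ≡ val s' (q i))

varsOf : {n : ℕ} → (Fin n → Var) → List Var
varsOf p = toList (tabulate p)

Defines : Form → List Var → ({Φ : Domain} → Team Φ → Set) → Set
Defines φ avs A = (Φ : Domain) → Unique Φ →
  ((x : Var) → x ∈ vars φ → x ∈ Φ) → ((x : Var) → x ∈ avs → x ∈ Φ) →
  (T : Team Φ) → Sat T φ ⇔ A T

{-# OPTIONS --safe #-}
-- By induction on φ, every family of teams satisfying φ can be coloured with
-- colours φ colours (one for a literal, summed along ⊻, multiplied along ∧, ∨ and ∨̇) so that two
-- disjoint members of the same colour have a union satisfying φ: literals are closed under unions,
-- and splits of two disjoint teams combine into a split of their union. So if φ holds on K pairwise
-- disjoint teams, no two of which have a union satisfying φ, then K ≤ colours φ; moreover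
-- colours φ ² ≤ 2 ^ len φ.
-- For n = m + 1 such families of size 2 ^ 2 ^ m are indexed by the Boolean functions f of m
-- variables: the graph of f (q = f(p₂…pₙ)) for dependence, and the teams where p₁ = f(p₂…pₙ) but
-- q₁ ≠ f(q₂…qₙ) for exclusion. Two functions differing at one input yield a violating pair of
-- assignments, and fresh variables recording the truth table of f keep the teams disjoint.
-- Hence 2 ^ 2 ^ m ≤ colours φ, i.e. 2 ^ n ≤ len φ.
module Submission where

open import Defs
open import Data.Nat using (ℕ; zero; suc; _+_; _*_; _^_; _≤_; _<_; _≡ᵇ_; z≤n; s≤s; >-nonZero)
open import Data.Nat.Properties
  using (_≟_; ≤-refl; ≤-trans; <-≤-trans; m≤m+n; m≤m*n; m≤n*m; +-mono-≤; +-monoʳ-<;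
         *-mono-≤; *-monoˡ-≤; *-monoʳ-≤; *-comm; +-identityʳ; +-cancelˡ-≡; ^-distribˡ-+-*; ^-monoʳ-<;
         m^n>0; ≮⇒≥; <⇒≱; ≡ᵇ⇒≡; ≡⇒≡ᵇ; module ≤-Reasoning)
open import Data.Nat.Tactic.RingSolver using (solve)
open import Data.Bool using (Bool; true; false; _∨_; _∧_; T)
open import Data.Bool.Properties using (∨-idem; ∨-commutativeMonoid) renaming (_≟_ to _≟ᴮ_)
open import Data.Fin using (Fin; zero; suc; toℕ; combine; join; splitAt; funToFin; finToFun)
open import Data.Fin.Properties
  using (combine-injective; splitAt-join; funToFin-finToFin; 2↔Bool; toℕ-injective; toℕ<n;
         suc-injective; injective⇒≤; all?; ¬∀⟶∃¬)
  renaming (_≟_ to _≟ᶠ_)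
import Data.Vec.Functional as Vector
open import Data.List using (List; []; _∷_; _++_; upTo)
open import Data.List.Relation.Unary.All as All using (universal)
open import Data.List.Relation.Unary.Any using (here; there)
open import Data.List.Membership.Propositional using (_∈_)
open import Data.List.Membership.Propositional.Properties using (∈-upTo⁺; ∈-++⁺ˡ; ∈-++⁺ʳ)
open import Data.List.Relation.Unary.Unique.Propositional.Properties using (upTo⁺)
open import Data.List.Extrema.Nat using (max; xs≤max)
open import Data.Product using (Σ; ∃; _×_; _,_; proj₁; proj₂)
open import Data.Sum using (_⊎_; inj₁; inj₂)
open import Data.Sum.Properties using (inj₁-injective; inj₂-injective)
open import Data.Unit using (tt)
open import Data.Empty using (⊥; ⊥-elim)
open import Function using (_∘_; _⇔_; Inverse; Equivalence)
open import Function.Definitions using (Injective)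
open import Relation.Nullary using (¬_; ¬?; yes; no; does; contradiction)
open import Relation.Nullary.Decidable using (dec-true; _×-dec_)
open import Relation.Unary using (Decidable)
open import Relation.Binary.PropositionalEquality
open import Algebra.Bundles using (CommutativeMonoid)
open import Algebra.Properties.CommutativeSemigroup (CommutativeMonoid.commutativeSemigroup ∨-commutativeMonoid)
  using (interchange)

private
  variable
    Φ : Domain

_∪_ : Team Φ → Team Φ → Team Φ
(A ∪ B) s = A s ∨ B s

module _ (A B : Team Φ) {s : Assign Φ} where

  ∪-introˡ : A s ≡ true → (A ∪ B) s ≡ true
  ∪-introˡ e rewrite e = refl

  ∪-introʳ : B s ≡ true → (A ∪ B) s ≡ true
  ∪-introʳ e with A s
  ... | true = refl
  ... | false = e

  ∪-elim : (A ∪ B) s ≡ true → A s ≡ true ⊎ B s ≡ true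
  ∪-elim e with A s
  ... | true = inj₁ refl
  ... | false = inj₂ e

  disjoint-elim : Disjoint A B → A s ≡ true → B s ≡ true → ⊥
  disjoint-elim d eA eB with trans (sym (d s)) (cong₂ _∧_ eA eB)
  ... | ()

disjoint-intro : (A B : Team Φ) → (∀ s → A s ≡ true → B s ≡ true → ⊥) → Disjoint A B
disjoint-intro A B h s with A s in eA | B s in eB
... | true | true = ⊥-elim (h s eA eB)
... | true | false = refl
... | false | _ = refl

module _ {T : Team Φ} (A B : Team Φ) (split : IsSplit T A B) {s : Assign Φ} where

  split-⊆ˡ : A s ≡ true → T s ≡ true
  split-⊆ˡ e = trans (split s) (∪-introˡ A B e)

  split-⊆ʳ : B s ≡ true → T s ≡ true
  split-⊆ʳ e = trans (split s) (∪-introʳ A B e)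

module _ {T T′ : Team Φ} (A B A′ B′ : Team Φ)
         (split : IsSplit T A B) (split′ : IsSplit T′ A′ B′) where

  ∪-isSplit : IsSplit (T ∪ T′) (A ∪ A′) (B ∪ B′)
  ∪-isSplit s = trans (cong₂ _∨_ (split s) (split′ s)) (interchange (A s) (B s) (A′ s) (B′ s))

  split-disjointˡ : Disjoint T T′ → Disjoint A A′
  split-disjointˡ d = disjoint-intro A A′ λ s a a′ →
    disjoint-elim T T′ d (split-⊆ˡ A B split a) (split-⊆ˡ A′ B′ split′ a′)

  split-disjointʳ : Disjoint T T′ → Disjoint B B′
  split-disjointʳ d = disjoint-intro B B′ λ s b b′ →
    disjoint-elim T T′ d (split-⊆ʳ A B split b) (split-⊆ʳ A′ B′ split′ b′)

  ∪-disjoint : Disjoint A B → Disjoint A′ B′ → Disjoint T T′ → Disjoint (A ∪ A′) (B ∪ B′)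
  ∪-disjoint d d′ dT = disjoint-intro (A ∪ A′) (B ∪ B′) λ s a b →
    cases (∪-elim A A′ a) (∪-elim B B′ b)
    where
    cases : ∀ {s} → A s ≡ true ⊎ A′ s ≡ true → B s ≡ true ⊎ B′ s ≡ true → ⊥
    cases (inj₁ a) (inj₁ b) = disjoint-elim A B d a b
    cases (inj₁ a) (inj₂ b′) =
      disjoint-elim T T′ dT (split-⊆ˡ A B split a) (split-⊆ʳ A′ B′ split′ b′)
    cases (inj₂ a′) (inj₁ b) =
      disjoint-elim T T′ dT (split-⊆ʳ A B split b) (split-⊆ˡ A′ B′ split′ a′)
    cases (inj₂ a′) (inj₂ b′) = disjoint-elim A′ B′ d′ a′ b′

module _ (A B : Team Φ) where

  empty-∪ : Empty A → Empty B → Empty (A ∪ B)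
  empty-∪ a b s rewrite a s | b s = refl

  empty-∪⁻ : Empty (A ∪ B) → Empty A
  empty-∪⁻ e s with A s in eA
  ... | true = trans (sym (∪-introˡ A B eA)) (e s)
  ... | false = refl

  allVal-∪ : ∀ {x b} → AllVal A x b → AllVal B x b → AllVal (A ∪ B) x b
  allVal-∪ a b s e with ∪-elim A B e
  ... | inj₁ eA = a s eA
  ... | inj₂ eB = b s eB

  allVal-∪⁻ : ∀ {x b} → AllVal (A ∪ B) x b → AllVal A x b
  allVal-∪⁻ h s e = h s (∪-introˡ A B e)

  satLit-∪ : (l : Lit) → SatLit A l → SatLit B l → SatLit (A ∪ B) l
  satLit-∪ lTop a b = tt
  satLit-∪ lBot a b = empty-∪ a b
  satLit-∪ lNBot a b = a ∘ empty-∪⁻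
  satLit-∪ (lPos x) a b = allVal-∪ a b
  satLit-∪ (lNeg x) a b = allVal-∪ a b
  satLit-∪ (lNPos x) a b = a ∘ allVal-∪⁻
  satLit-∪ (lNNeg x) a b = a ∘ allVal-∪⁻

join-injective : ∀ m n → Injective _≡_ _≡_ (join m n)
join-injective m n {x} {y} e = begin
  x                          ≡⟨ splitAt-join m n x ⟨
  splitAt m (join m n x)     ≡⟨ cong (splitAt m) e ⟩
  splitAt m (join m n y)     ≡⟨ splitAt-join m n y ⟩
  y                          ∎
  where open ≡-Reasoning

colours : Form → ℕ
colours (lit l) = 1
colours (φ ⊻ ψ) = colours φ + colours ψ
colours (φ ∧ᶠ ψ) = colours φ * colours ψ
colours (φ ∨ᶠ ψ) = colours φ * colours ψ
colours (φ ∨̇ ψ) = colours φ * colours ψ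

record Colouring {I : Set} (T : I → Team Φ) (φ : Form) (k : ℕ) : Set where
  field
    colour : I → Fin k
    merge : ∀ i j → Disjoint (T i) (T j) → colour i ≡ colour j → Sat (T i ∪ T j) φ

open Colouring

module _ {I : Set} {T : I → Team Φ} where

  ⊻-colouring : ∀ {φ ψ a b} (sat : ∀ i → Sat (T i) (φ ⊻ ψ)) →
    Colouring {I = Σ I λ i → Sat (T i) φ} (T ∘ proj₁) φ a →
    Colouring {I = Σ I λ i → Sat (T i) ψ} (T ∘ proj₁) ψ b →
    Colouring T (φ ⊻ ψ) (a + b)
  ⊻-colouring {φ} {ψ} {a} {b} sat c₁ c₂ = record
    { colour = λ i → join a b (side i (sat i))
    ; merge = merge′
    }
    where
    side : ∀ i → Sat (T i) φ ⊎ Sat (T i) ψ → Fin a ⊎ Fin b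
    side i (inj₁ x) = inj₁ (colour c₁ (i , x))
    side i (inj₂ y) = inj₂ (colour c₂ (i , y))
    merge′ : ∀ i j → Disjoint (T i) (T j) → join a b (side i (sat i)) ≡ join a b (side j (sat j)) →
      Sat (T i ∪ T j) (φ ⊻ ψ)
    merge′ i j d e = merge″ (sat i) (sat j) (join-injective a b e)
      where
      merge″ : ∀ x y → side i x ≡ side j y → Sat (T i ∪ T j) (φ ⊻ ψ)
      merge″ (inj₁ x) (inj₁ y) e = inj₁ (merge c₁ (i , x) (j , y) d (inj₁-injective e))
      merge″ (inj₂ x) (inj₂ y) e = inj₂ (merge c₂ (i , x) (j , y) d (inj₂-injective e))

  split-colouring : ∀ {φ ψ χ a b} (A B : I → Team Φ) (split : ∀ i → IsSplit (T i) (A i) (B i)) →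
    Colouring A φ a → Colouring B ψ b →
    (∀ i j → Disjoint (T i) (T j) → Sat (A i ∪ A j) φ → Sat (B i ∪ B j) ψ → Sat (T i ∪ T j) χ) →
    Colouring T χ (a * b)
  split-colouring A B split c₁ c₂ glue = record
    { colour = λ i → combine (colour c₁ i) (colour c₂ i)
    ; merge = λ i j d e → let e₁ , e₂ = combine-injective _ _ _ _ e in
        glue i j d (merge c₁ i j (split-disjointˡ (A i) (B i) (A j) (B j) (split i) (split j) d) e₁)
                   (merge c₂ i j (split-disjointʳ (A i) (B i) (A j) (B j) (split i) (split j) d) e₂)
    }

colouring : {I : Set} (φ : Form) (T : I → Team Φ) → (∀ i → Sat (T i) φ) → Colouring T φ (colours φ)
colouring (lit l) T sat = record
  { colour = λ _ → zero
  ; merge = λ i j _ _ → satLit-∪ (T i) (T j) l (sat i) (sat j)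
  }
colouring (φ ⊻ ψ) T sat = ⊻-colouring sat (colouring φ _ proj₂) (colouring ψ _ proj₂)
colouring (φ ∧ᶠ ψ) T sat =
  split-colouring T T (λ i s → sym (∨-idem (T i s)))
    (colouring φ T (proj₁ ∘ sat)) (colouring ψ T (proj₂ ∘ sat)) λ _ _ _ → _,_
colouring {Φ} {I} (φ ∨ᶠ ψ) T sat = split-colouring A B split (colouring φ A satA) (colouring ψ B satB)
  λ i j _ satA∪ satB∪ → A i ∪ A j , B i ∪ B j ,
    ∪-isSplit (A i) (B i) (A j) (B j) (split i) (split j) , satA∪ , satB∪
  where
  A B : I → Team Φ
  A i = proj₁ (sat i)
  B i = proj₁ (proj₂ (sat i))
  split : ∀ i → IsSplit (T i) (A i) (B i)
  split i = proj₁ (proj₂ (proj₂ (sat i)))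
  satA : ∀ i → Sat (A i) φ
  satA i = proj₁ (proj₂ (proj₂ (proj₂ (sat i))))
  satB : ∀ i → Sat (B i) ψ
  satB i = proj₂ (proj₂ (proj₂ (proj₂ (sat i))))
colouring {Φ} {I} (φ ∨̇ ψ) T sat = split-colouring A B split (colouring φ A satA) (colouring ψ B satB)
  λ i j d satA∪ satB∪ → A i ∪ A j , B i ∪ B j ,
    ∪-isSplit (A i) (B i) (A j) (B j) (split i) (split j) ,
    ∪-disjoint (A i) (B i) (A j) (B j) (split i) (split j) (disjoint i) (disjoint j) d , satA∪ , satB∪
  where
  A B : I → Team Φ
  A i = proj₁ (sat i)
  B i = proj₁ (proj₂ (sat i))
  split : ∀ i → IsSplit (T i) (A i) (B i)
  split i = proj₁ (proj₂ (proj₂ (sat i)))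
  disjoint : ∀ i → Disjoint (A i) (B i)
  disjoint i = proj₁ (proj₂ (proj₂ (proj₂ (sat i))))
  satA : ∀ i → Sat (A i) φ
  satA i = proj₁ (proj₂ (proj₂ (proj₂ (proj₂ (sat i)))))
  satB : ∀ i → Sat (B i) ψ
  satB i = proj₂ (proj₂ (proj₂ (proj₂ (proj₂ (sat i)))))

colours-positive : (φ : Form) → 1 ≤ colours φ
colours-positive (lit l) = ≤-refl
colours-positive (φ ⊻ ψ) = ≤-trans (colours-positive φ) (m≤m+n _ _)
colours-positive (φ ∧ᶠ ψ) = *-mono-≤ (colours-positive φ) (colours-positive ψ)
colours-positive (φ ∨ᶠ ψ) = *-mono-≤ (colours-positive φ) (colours-positive ψ)
colours-positive (φ ∨̇ ψ) = *-mono-≤ (colours-positive φ) (colours-positive ψ)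

module _ (a b : ℕ) {A B : ℕ} (a²≤A : a * a ≤ A) (b²≤B : b * b ≤ B) where
  open ≤-Reasoning

  square-*-≤ : (a * b) * (a * b) ≤ 8 * (A * B)
  square-*-≤ = begin
    (a * b) * (a * b) ≡⟨ solve (a ∷ b ∷ []) ⟩
    (a * a) * (b * b) ≤⟨ *-mono-≤ a²≤A b²≤B ⟩
    A * B             ≤⟨ m≤n*m (A * B) 8 ⟩
    8 * (A * B)       ∎

  square-+-≤ : 1 ≤ a → 1 ≤ b → (a + b) * (a + b) ≤ 8 * (A * B)
  square-+-≤ 1≤a 1≤b = begin
    (a + b) * (a + b)             ≤⟨ *-mono-≤ a+b≤2ab a+b≤2ab ⟩
    (2 * (a * b)) * (2 * (a * b)) ≡⟨ solve (a ∷ b ∷ []) ⟩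
    4 * ((a * a) * (b * b))       ≤⟨ *-monoʳ-≤ 4 (*-mono-≤ a²≤A b²≤B) ⟩
    4 * (A * B)                   ≤⟨ *-monoˡ-≤ (A * B) {4} {8} (s≤s (s≤s (s≤s (s≤s z≤n)))) ⟩
    8 * (A * B)                   ∎
    where
    a+b≤2ab : a + b ≤ 2 * (a * b)
    a+b≤2ab = begin
      a + b               ≤⟨ +-mono-≤ (m≤m*n a b {{>-nonZero 1≤b}}) (m≤n*m b a {{>-nonZero 1≤a}}) ⟩
      a * b + a * b       ≡⟨ solve (a ∷ b ∷ []) ⟩
      2 * (a * b)         ∎

≤2^len-binary : (φ ψ : Form) {c : ℕ} →
  c ≤ 8 * (2 ^ len φ * 2 ^ len ψ) → c ≤ 2 ^ (len φ + len ψ + 3)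
≤2^len-binary φ ψ {c} c≤ = begin
  c                             ≤⟨ c≤ ⟩
  8 * (2 ^ len φ * 2 ^ len ψ)   ≡⟨ *-comm 8 (2 ^ len φ * 2 ^ len ψ) ⟩
  (2 ^ len φ * 2 ^ len ψ) * 8   ≡⟨ cong (_* 8) (^-distribˡ-+-* 2 (len φ) (len ψ)) ⟨
  2 ^ (len φ + len ψ) * 8       ≡⟨ ^-distribˡ-+-* 2 (len φ + len ψ) 3 ⟨
  2 ^ (len φ + len ψ + 3)       ∎
  where open ≤-Reasoning

colours²≤2^len : (φ : Form) → colours φ * colours φ ≤ 2 ^ len φ
colours²≤2^len (lit l) = m^n>0 2 (litLen l)
colours²≤2^len (φ ⊻ ψ) = ≤2^len-binary φ ψ (square-+-≤ (colours φ) (colours ψ)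
  (colours²≤2^len φ) (colours²≤2^len ψ) (colours-positive φ) (colours-positive ψ))
colours²≤2^len (φ ∧ᶠ ψ) = ≤2^len-binary φ ψ
  (square-*-≤ (colours φ) (colours ψ) (colours²≤2^len φ) (colours²≤2^len ψ))
colours²≤2^len (φ ∨ᶠ ψ) = ≤2^len-binary φ ψ
  (square-*-≤ (colours φ) (colours ψ) (colours²≤2^len φ) (colours²≤2^len ψ))
colours²≤2^len (φ ∨̇ ψ) = ≤2^len-binary φ ψ
  (square-*-≤ (colours φ) (colours ψ) (colours²≤2^len φ) (colours²≤2^len ψ))

record Separating (K : ℕ) (A : Team Φ → Set) : Set₁ where
  field
    member : Fin K → Team Φ
    member-satisfies : ∀ k → A (member k)
    member-disjoint : ∀ {k k′} → k ≢ k′ → Disjoint (member k) (member k′)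
    ∪-violates : ∀ {k k′} → k ≢ k′ → ¬ A (member k ∪ member k′)

separating-⇔ : ∀ {K} {A B : Team Φ → Set} →
  (∀ T → B T ⇔ A T) → Separating K A → Separating K B
separating-⇔ B⇔A F = record
  { member = member
  ; member-satisfies = Equivalence.from (B⇔A _) ∘ member-satisfies
  ; member-disjoint = member-disjoint
  ; ∪-violates = λ k≢k′ → ∪-violates k≢k′ ∘ Equivalence.to (B⇔A _)
  }
  where open Separating F

separating⇒≤colours : ∀ {K} (φ : Form) → Separating {Φ} K (λ T → Sat T φ) → K ≤ colours φ
separating⇒≤colours φ F = injective⇒≤ colour-injective
  where
  open Separating F
  c = colouring φ member member-satisfies
  colour-injective : Injective _≡_ _≡_ (colour c)
  colour-injective {k} {k′} e with k ≟ᶠ k′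
  ... | yes k≡k′ = k≡k′
  ... | no k≢k′ = contradiction (merge c k k′ (member-disjoint k≢k′) e) (∪-violates k≢k′)

2^H≤colours⇒2H≤len : ∀ {H} (φ : Form) → 2 ^ H ≤ colours φ → 2 * H ≤ len φ
2^H≤colours⇒2H≤len {H} φ 2^H≤c = ≮⇒≥ λ len<2H → <⇒≱ (^-monoʳ-< 2 (s≤s (s≤s z≤n)) len<2H) (begin
  2 ^ (2 * H)           ≡⟨ cong (2 ^_) (cong (H +_) (+-identityʳ H)) ⟩
  2 ^ (H + H)           ≡⟨ ^-distribˡ-+-* 2 H H ⟩
  2 ^ H * 2 ^ H         ≤⟨ *-mono-≤ 2^H≤c 2^H≤c ⟩
  colours φ * colours φ ≤⟨ colours²≤2^len φ ⟩
  2 ^ len φ             ∎)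
  where open ≤-Reasoning

funToFin-cong : ∀ {m n} {f g : Fin m → Fin n} → f ≗ g → funToFin f ≡ funToFin g
funToFin-cong {zero} _ = refl
funToFin-cong {suc m} f≗g = cong₂ combine (f≗g zero) (funToFin-cong (f≗g ∘ suc))

module _ {n : ℕ} where

  bits : Fin (2 ^ n) → Fin n → Bool
  bits k = Inverse.to 2↔Bool ∘ finToFun {2} {n} k

  fromBits : (Fin n → Bool) → Fin (2 ^ n)
  fromBits u = funToFin (Inverse.from 2↔Bool ∘ u)

  fromBits-cong : {u v : Fin n → Bool} → u ≗ v → fromBits u ≡ fromBits v
  fromBits-cong u≗v = funToFin-cong (cong (Inverse.from 2↔Bool) ∘ u≗v)

  fromBits-bits : (k : Fin (2 ^ n)) → fromBits (bits k) ≡ k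
  fromBits-bits k = trans (funToFin-cong (Inverse.strictlyInverseʳ 2↔Bool ∘ finToFun {2} {n} k))
                          (funToFin-finToFin {n} k)

  bits-injective : {k k′ : Fin (2 ^ n)} → bits k ≗ bits k′ → k ≡ k′
  bits-injective {k} {k′} same = begin
    k                     ≡⟨ fromBits-bits k ⟨
    fromBits (bits k)     ≡⟨ fromBits-cong same ⟩
    fromBits (bits k′)    ≡⟨ fromBits-bits k′ ⟩
    k′                    ∎
    where open ≡-Reasoning

  bits-separates : {k k′ : Fin (2 ^ n)} → k ≢ k′ → ∃ λ j → bits k j ≢ bits k′ j
  bits-separates {k} {k′} k≢k′ =
    ¬∀⟶∃¬ n _ (λ j → bits k j ≟ᴮ bits k′ j) (k≢k′ ∘ bits-injective)

module _ {Φ : Domain} {P : Assign Φ → Set} (P? : Decidable P) where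

  ⟦_⟧ : Team Φ
  ⟦_⟧ s = does (P? s)

  ∈⟦⟧⁺ : ∀ {s} → P s → ⟦_⟧ s ≡ true
  ∈⟦⟧⁺ {s} = dec-true (P? s)

  ∈⟦⟧⁻ : ∀ {s} → ⟦_⟧ s ≡ true → P s
  ∈⟦⟧⁻ {s} e with P? s
  ... | yes Ps = Ps

val-universal : (f : Var → Bool) {Φ : Domain} {x : Var} → x ∈ Φ → val (universal f Φ) x ≡ f x
val-universal f {y ∷ Φ} {x} x∈ with y ≡ᵇ x in y≡ᵇx | x∈
... | true | _ = cong f (≡ᵇ⇒≡ y x (subst T (sym y≡ᵇx) tt))
... | false | here refl = contradiction (subst T y≡ᵇx (≡⇒≡ᵇ y y refl)) λ ()
... | false | there x∈Φ = val-universal f x∈Φ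

override : ∀ {k} → (Fin k → Var) → (Fin k → Bool) → (Var → Bool) → Var → Bool
override {zero} keys vals f = f
override {suc k} keys vals f x with keys zero ≟ x
... | yes _ = vals zero
... | no _ = override (keys ∘ suc) (vals ∘ suc) f x

override-key : ∀ {k} {keys : Fin k → Var} (vals : Fin k → Bool) (f : Var → Bool) →
  Injective _≡_ _≡_ keys → ∀ i → override keys vals f (keys i) ≡ vals i
override-key {keys = keys} vals f inj zero with keys zero ≟ keys zero
... | yes _ = refl
... | no ne = contradiction refl ne
override-key {keys = keys} vals f inj (suc i) with keys zero ≟ keys (suc i)
... | yes e = contradiction (inj e) λ ()
... | no _ = override-key (vals ∘ suc) f (suc-injective ∘ inj) i

override-other : ∀ {k} {keys : Fin k → Var} (vals : Fin k → Bool) (f : Var → Bool) {x : Var} →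
  (∀ i → keys i ≢ x) → override keys vals f x ≡ f x
override-other {zero} vals f _ = refl
override-other {suc k} {keys} vals f {x} fresh with keys zero ≟ x
... | yes e = contradiction e (fresh zero)
... | no _ = override-other (vals ∘ suc) f (fresh ∘ suc)

module Construction (m M : ℕ) where

  H : ℕ
  H = 2 ^ m

  domain : Domain
  domain = upTo (M + H)

  tag : Fin H → Var
  tag j = M + toℕ j

  tags : Assign domain → Fin H → Bool
  tags s j = val s (tag j)

  input : (Fin (suc m) → Var) → Assign domain → Fin H
  input r s = fromBits λ i → val s (r (suc i))

  assign : (Fin H → Bool) → (Var → Bool) → Assign domain
  assign w f = universal (override tag w f) domain

  tags-assign : ∀ w f → tags (assign w f) ≗ w
  tags-assign w f j = trans (val-universal _ (∈-upTo⁺ (+-monoʳ-< M (toℕ<n j))))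
    (override-key w f (toℕ-injective ∘ +-cancelˡ-≡ M _ _) j)

  val-assign : ∀ w f {x} → x < M → val (assign w f) x ≡ f x
  val-assign w f {x} x<M = trans (val-universal _ (∈-upTo⁺ (<-≤-trans x<M (m≤m+n M H))))
    (override-other w f λ j tag≡x → <⇒≱ x<M (subst (M ≤_) tag≡x (m≤m+n M (toℕ j))))

  input-≡ : ∀ r s {j : Fin H} → (∀ i → val s (r (suc i)) ≡ bits j i) → input r s ≡ j
  input-≡ r s {j} agree = trans (fromBits-cong agree) (fromBits-bits {m} j)

  tagged-disjoint : (F : Fin (2 ^ H) → Team domain) → (∀ k s → F k s ≡ true → tags s ≗ bits k) →
    ∀ {k k′} → k ≢ k′ → Disjoint (F k) (F k′)
  tagged-disjoint F tagged {k} {k′} k≢k′ = disjoint-intro (F k) (F k′) λ s s∈ s∈′ →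
    k≢k′ (bits-injective λ j → trans (sym (tagged k s s∈ j)) (tagged k′ s s∈′ j))

  module Dependence (p : Fin (suc m) → Var) (q : Var) (p-injective : Injective _≡_ _≡_ p)
                    (p≢q : ∀ i → p i ≢ q) (p<M : ∀ i → p i < M) (q<M : q < M) where

    Graph : Fin (2 ^ H) → Assign domain → Set
    Graph k s = tags s ≗ bits k × val s q ≡ bits k (input p s)

    graph? : ∀ k → Decidable (Graph k)
    graph? k s = all? (λ j → tags s j ≟ᴮ bits k j) ×-dec (val s q ≟ᴮ bits k (input p s))

    graph : Fin (2 ^ H) → Team domain
    graph k = ⟦ graph? k ⟧

    graph-dependence : ∀ k → DepAtom (graph k) p q
    graph-dependence k s s′ s∈ s′∈ agree = begin
      val s q             ≡⟨ proj₂ (∈⟦⟧⁻ (graph? k) s∈) ⟩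
      bits k (input p s)  ≡⟨ cong (bits k) (fromBits-cong (agree ∘ suc)) ⟩
      bits k (input p s′) ≡⟨ proj₂ (∈⟦⟧⁻ (graph? k) s′∈) ⟨
      val s′ q            ∎
      where open ≡-Reasoning

    point : Fin (2 ^ H) → Fin H → Bool → Assign domain
    point k j c = assign (bits k) (override p (false Vector.∷ bits j) λ _ → c)

    module _ (k : Fin (2 ^ H)) (j : Fin H) (c : Bool) where

      point-p : ∀ i → val (point k j c) (p i) ≡ (false Vector.∷ bits j) i
      point-p i = trans (val-assign _ _ (p<M i)) (override-key _ _ p-injective i)

      point-q : val (point k j c) q ≡ c
      point-q = trans (val-assign _ _ q<M) (override-other _ _ p≢q)

      point-input : input p (point k j c) ≡ j
      point-input = input-≡ p _ (point-p ∘ suc)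

    point∈graph : ∀ k j → graph k (point k j (bits k j)) ≡ true
    point∈graph k j = ∈⟦⟧⁺ (graph? k)
      (tags-assign _ _ , trans (point-q k j _) (cong (bits k) (sym (point-input k j _))))

    graph-∪-violates : ∀ {k k′} → k ≢ k′ → ¬ DepAtom (graph k ∪ graph k′) p q
    graph-∪-violates {k} {k′} k≢k′ dep with j , differ ← bits-separates {H} k≢k′ = differ (begin
      bits k j         ≡⟨ point-q k j _ ⟨
      val s q          ≡⟨ dep s s′ (∪-introˡ (graph k) (graph k′) (point∈graph k j))
                                   (∪-introʳ (graph k) (graph k′) (point∈graph k′ j))
                                   (λ i → trans (point-p k j _ i) (sym (point-p k′ j _ i))) ⟩
      val s′ q         ≡⟨ point-q k′ j _ ⟩
      bits k′ j        ∎)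
      where
      open ≡-Reasoning
      s = point k j (bits k j)
      s′ = point k′ j (bits k′ j)

    separating : Separating (2 ^ H) (λ T → DepAtom T p q)
    separating = record
      { member = graph
      ; member-satisfies = graph-dependence
      ; member-disjoint = tagged-disjoint graph λ k s → proj₁ ∘ ∈⟦⟧⁻ (graph? k)
      ; ∪-violates = graph-∪-violates
      }

  module Exclusion (p qs : Fin (suc m) → Var)
                   (p-injective : Injective _≡_ _≡_ p) (qs-injective : Injective _≡_ _≡_ qs)
                   (p≢qs : ∀ i i′ → p i ≢ qs i′)
                   (p<M : ∀ i → p i < M) (qs<M : ∀ i → qs i < M) where

    OnOff : Fin (2 ^ H) → Assign domain → Set
    OnOff k s = tags s ≗ bits k
              × val s (p zero) ≡ bits k (input p s)
              × val s (qs zero) ≢ bits k (input qs s)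

    onOff? : ∀ k → Decidable (OnOff k)
    onOff? k s = all? (λ j → tags s j ≟ᴮ bits k j)
      ×-dec (val s (p zero) ≟ᴮ bits k (input p s)) ×-dec ¬? (val s (qs zero) ≟ᴮ bits k (input qs s))

    onOff : Fin (2 ^ H) → Team domain
    onOff k = ⟦ onOff? k ⟧

    onOff-exclusion : ∀ k → ExclAtom (onOff k) p qs
    onOff-exclusion k s s′ s∈ s′∈ agree = proj₂ (proj₂ (∈⟦⟧⁻ (onOff? k) s′∈)) (begin
      val s′ (qs zero)     ≡⟨ agree zero ⟨
      val s (p zero)       ≡⟨ proj₁ (proj₂ (∈⟦⟧⁻ (onOff? k) s∈)) ⟩
      bits k (input p s)   ≡⟨ cong (bits k) (fromBits-cong (agree ∘ suc)) ⟩
      bits k (input qs s′) ∎)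
      where open ≡-Reasoning

    point : Fin (2 ^ H) → Fin H → Bool → Bool → Assign domain
    point k j c c′ =
      assign (bits k) (override p (c Vector.∷ bits j) (override qs (c′ Vector.∷ bits j) λ _ → false))

    module _ (k : Fin (2 ^ H)) (j : Fin H) (c c′ : Bool) where

      point-p : ∀ i → val (point k j c c′) (p i) ≡ (c Vector.∷ bits j) i
      point-p i = trans (val-assign _ _ (p<M i)) (override-key _ _ p-injective i)

      point-qs : ∀ i → val (point k j c c′) (qs i) ≡ (c′ Vector.∷ bits j) i
      point-qs i = trans (val-assign _ _ (qs<M i))
        (trans (override-other _ _ λ i′ → p≢qs i′ i) (override-key _ _ qs-injective i))

      point∈onOff : c ≡ bits k j → c′ ≢ bits k j → onOff k (point k j c c′) ≡ true
      point∈onOff c≡ c′≢ = ∈⟦⟧⁺ (onOff? k)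
        ( tags-assign _ _
        , trans (point-p zero) (trans c≡ (cong (bits k) (sym (input-≡ p _ (point-p ∘ suc)))))
        , λ e → c′≢ (trans (sym (point-qs zero))
                          (trans e (cong (bits k) (input-≡ qs _ (point-qs ∘ suc))))))

    onOff-∪-violates : ∀ {k k′} → k ≢ k′ → ¬ ExclAtom (onOff k ∪ onOff k′) p qs
    onOff-∪-violates {k} {k′} k≢k′ excl with j , differ ← bits-separates {H} k≢k′ =
      excl s s′ (∪-introˡ (onOff k) (onOff k′) (point∈onOff k j _ _ refl (differ ∘ sym)))
                (∪-introʳ (onOff k) (onOff k′) (point∈onOff k′ j _ _ refl differ))
                (λ i → trans (point-p k j _ _ i) (sym (point-qs k′ j _ _ i)))
      where
      s = point k j (bits k j) (bits k′ j)
      s′ = point k′ j (bits k′ j) (bits k j)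

    separating : Separating (2 ^ H) (λ T → ExclAtom T p qs)
    separating = record
      { member = onOff
      ; member-satisfies = onOff-exclusion
      ; member-disjoint = tagged-disjoint onOff λ k s → proj₁ ∘ ∈⟦⟧⁻ (onOff? k)
      ; ∪-violates = onOff-∪-violates
      }

∈-varsOf : ∀ {n} (p : Fin n → Var) (i : Fin n) → p i ∈ varsOf p
∈-varsOf p zero = here refl
∈-varsOf p (suc i) = there (∈-varsOf (p ∘ suc) i)

separable⇒2H≤len : (φ : Form) (avs : List Var) (A : {Φ : Domain} → Team Φ → Set) (H : ℕ) →
  Defines φ avs A →
  ((M : ℕ) → (∀ x → x ∈ avs → x < M) → Separating {upTo (M + H)} (2 ^ H) A) →
  2 * H ≤ len φ
separable⇒2H≤len φ avs A H defines separating = 2^H≤colours⇒2H≤len {H} φ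
  (separating⇒≤colours φ (separating-⇔ sat⇔A (separating M (λ x → below x ∘ ∈-++⁺ʳ (vars φ)))))
  where
  M : ℕ
  M = suc (max 0 (vars φ ++ avs))
  below : ∀ x → x ∈ vars φ ++ avs → x < M
  below x x∈ = s≤s (All.lookup (xs≤max 0 (vars φ ++ avs)) x∈)
  inDomain : ∀ x → x ∈ vars φ ++ avs → x ∈ upTo (M + H)
  inDomain x x∈ = ∈-upTo⁺ (<-≤-trans (below x x∈) (m≤m+n M H))
  sat⇔A : (T : Team (upTo (M + H))) → Sat T φ ⇔ A T
  sat⇔A = defines (upTo (M + H)) (upTo⁺ (M + H))
    (λ x → inDomain x ∘ ∈-++⁺ˡ) (λ x → inDomain x ∘ ∈-++⁺ʳ (vars φ))

theorem3p10 : (n : ℕ) → 1 ≤ n →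
    (p : Fin n → Var) (q : Var) (qs : Fin n → Var) →
    Injective _≡_ _≡_ p → Injective _≡_ _≡_ qs →
    ((i : Fin n) → p i ≢ q) → ((i : Fin n) → qs i ≢ q) →
    ((i j : Fin n) → p i ≢ qs j) →
    ((φ : Form) → Defines φ (q ∷ varsOf p) (λ T → DepAtom T p q) → 2 ^ n ≤ len φ)
    × ((φ : Form) → Defines φ (varsOf p ++ varsOf qs) (λ T → ExclAtom T p qs) → 2 ^ n ≤ len φ)
theorem3p10 (suc m) _ p q qs p-injective qs-injective p≢q _ p≢qs =
  (λ φ defines → separable⇒2H≤len φ _ _ (2 ^ m) defines λ M below →
     Construction.Dependence.separating m M p q p-injective p≢q
       (λ i → below (p i) (there (∈-varsOf p i))) (below q (here refl))) ,
  (λ φ defines → separable⇒2H≤len φ _ _ (2 ^ m) defines λ M below →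
     Construction.Exclusion.separating m M p qs p-injective qs-injective p≢qs
       (λ i → below (p i) (∈-++⁺ˡ (∈-varsOf p i)))
       (λ i → below (qs i) (∈-++⁺ʳ (varsOf p) (∈-varsOf qs i))))
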